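{- Let $k\ge 1$ and $t\ge 1$ be integers, and let $G_k=(V_k,E_k)$ be an undirected unweighted graph with girth at least $2k+1$, whose $m$ edges are numbered $1,\dots,m$. Let $S_a,S_b\in\{0,1\}^m$. Construct the undirected unweighted graph $G'$ as follows: take two copies $G_k^a$ and $G_k^b$ of the vertex set $V_k$ (writing $u^a,u^b$ for the copies of $u\in V_k$); for each $i$ with $S_a[i]=1$, where edge $i$ of $G_k$ is $\{u,v\}$, add a path of $t$ edges (with $t-1$ new internal vertices) between $u^a$ and $v^a$; for each $i$ with $S_b[i]=1$ add similarly a path of $t$ edges between $u^b$ and $v^b$; and for each $u\in V_k$ add the edge $\{u^a,u^b\}$. Let $g$ be the girth of $G'$ (the length of a shortest cycle, $\infty$ if none). If there exists $i$ with $S_a[i]=S_b[i]=1$, then $g\le 2t+2$. Otherwise, $g\ge (2k+1)t$. -}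

module Defs where

open import Data.Nat using (ℕ; zero; suc; _+_; _*_; _≤_; _<_; _<?_; s≤s; z≤n)
open import Data.Fin using (Fin)
open import Data.Bool using (Bool; true)
open import Data.Product using (Σ; _×_; _,_; proj₁; proj₂; ∃)
open import Data.Sum using (_⊎_)
open import Relation.Nullary using (¬_; yes; no)
open import Relation.Binary.PropositionalEquality using (_≡_)

record Graph : Set₁ where
  field
    V   : Set
    Adj : V → V → Set

open Graph public

record Cycle (G : Graph) (L : ℕ) : Set where
  field
    len≥3 : 3 ≤ L
    vert  : ℕ → V G
    close : vert L ≡ vert 0
    dist  : ∀ i j → i < L → j < L → vert i ≡ vert j → i ≡ j
    adj   : ∀ i → i < L → Adj G (vert i) (vert (suc i))

GirthAtLeast : Graph → ℕ → Set
GirthAtLeast G g = ∀ L → Cycle G L → g ≤ L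

GirthAtMost : Graph → ℕ → Set
GirthAtMost G g = Σ ℕ λ L → L ≤ g × Cycle G L

EdgeList : ℕ → ℕ → Set
EdgeList n m = Fin m → Fin n × Fin n

SimpleEdges : ∀ {n m} → EdgeList n m → Set
SimpleEdges {n} {m} E =
  (∀ i → ¬ (proj₁ (E i) ≡ proj₂ (E i))) ×
  (∀ i j → (E i ≡ E j ⊎ (proj₁ (E i) ≡ proj₂ (E j) × proj₂ (E i) ≡ proj₁ (E j))) → i ≡ j)

baseGraph : ∀ {n m} → EdgeList n m → Graph
baseGraph {n} {m} E = record
  { V = Fin n
  ; Adj = λ u v → ∃ λ i → (E i ≡ (u , v)) ⊎ (E i ≡ (v , u))
  }

data Side : Set where
  sa sb : Side

module Construction {n m : ℕ} (E : EdgeList n m) (Sa Sb : Fin m → Bool) (t : ℕ) where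

  S : Side → Fin m → Bool
  S sa = Sa
  S sb = Sb

  -- base s u  is the copy u^s;  inner s i j  (1 ≤ j < t, S_s[i] = 1) is the
  -- j-th internal vertex of the path of t edges replacing edge i on side s.
  data V' : Set where
    base  : Side → Fin n → V'
    inner : (s : Side) (i : Fin m) → S s i ≡ true →
            (j : ℕ) → 1 ≤ j → j < t → V'

  pt : (s : Side) (i : Fin m) → S s i ≡ true → ℕ → V'
  pt s i p zero = base s (proj₁ (E i))
  pt s i p (suc j) with suc j <? t
  ... | yes q = inner s i p (suc j) (s≤s z≤n) q
  ... | no _  = base s (proj₂ (E i))

  data Arc : V' → V' → Set where
    rung : ∀ u → Arc (base sa u) (base sb u)
    step : ∀ s i (p : S s i ≡ true) j → j < t → Arc (pt s i p j) (pt s i p (suc j))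

  G' : Graph
  G' = record { V = V' ; Adj = λ x y → Arc x y ⊎ Arc y x }

{-# OPTIONS --safe #-}

-- If edge i is present on both sides, its two t-paths and the rungs at its endpoints form a cycle
-- of length 2t + 2.
--
-- Otherwise, rotate a cycle of G′ so that it leaves a base vertex along a path. Inner vertices
-- have degree two, so the cycle runs along whole t-paths, each possibly followed by a rung; the
-- ends of these q paths project to a closed walk of length q in G_k, and the cycle has length at
-- least q t. The walk never turns back along the same edge: on the same side the cycle would
-- revisit a vertex two steps later, and the edge is not present on the other side. A
-- non-backtracking closed walk contains a cycle, so q ≥ 2k + 1.

module Submission where

open import Defs
open import Data.Nat using (ℕ; zero; suc; pred; _+_; _*_; _∸_; _≤_; _<_; _≤?_; _<?_; s≤s; z≤n)
open import Data.Nat.Properties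
open import Data.Nat.Induction using (<-rec)
open import Data.Nat.Tactic.RingSolver using (solve-∀)
open import Data.Fin using (Fin)
import Data.Fin as Fin
open import Data.Bool using (Bool; true; false)
import Data.Bool as Bool
open import Data.Product using (_×_; ∃; Σ; _,_; proj₁; proj₂)
open import Data.Sum using (_⊎_; inj₁; inj₂)
open import Axiom.UniquenessOfIdentityProofs using (module Decidable⇒UIP)
open import Data.Empty using (⊥; ⊥-elim)
open import Relation.Nullary using (¬_; yes; no; Dec; _×-dec_)
open import Relation.Binary.Definitions using (DecidableEquality; tri<; tri≈; tri>)
open import Relation.Binary.PropositionalEquality
open import Function using (_∘_)

module _ (s : ℕ → ℕ) (I : ℕ → Set) (L : ℕ)
         (I-zero : I 0) (I⇒≤ : ∀ {j} → I j → s j ≤ L)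
         (I-step : ∀ {j} → I j → s j < L → I (suc j) × s j < s (suc j)) where

  private
    Reached : Set
    Reached = ∃ λ q → s q ≡ L × I q × (∀ {i} → i < q → I i × s i < L)

    run : ∀ fuel j → L ∸ s j ≤ fuel → I j → (∀ {i} → i < j → I i × s i < L) → Reached
    run zero j gap Ij before = j , ≤-antisym (I⇒≤ Ij) (m∸n≡0⇒m≤n (n≤0⇒n≡0 gap)) , Ij , before
    run (suc fuel) j gap Ij before with m≤n⇒m<n∨m≡n (I⇒≤ Ij)
    ... | inj₂ sj≡L = j , sj≡L , Ij , before
    ... | inj₁ sj<L = run fuel (suc j) gap′ Ij′ before′
      where
      Ij′ : I (suc j)
      Ij′ = proj₁ (I-step Ij sj<L)
      gap′ : L ∸ s (suc j) ≤ fuel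
      gap′ = ≤-pred (<-≤-trans (∸-monoʳ-< (proj₂ (I-step Ij sj<L)) (I⇒≤ Ij′)) gap)
      before′ : ∀ {i} → i < suc j → I i × s i < L
      before′ i<1+j with m≤n⇒m<n∨m≡n (≤-pred i<1+j)
      ... | inj₁ i<j = before i<j
      ... | inj₂ refl = Ij , sj<L

  reaches-bound : ∃ λ q → s q ≡ L × I q × (∀ {i} → i < q → I i × s i < L)
  reaches-bound = run L 0 (m∸n≤m L (s 0)) I-zero (λ ())

-- Cycles and rotations

module _ {G : Graph} {L : ℕ} (C : Cycle G L) where
  open Cycle C

  cycle-length-pos : 0 < L
  cycle-length-pos = <-≤-trans (s≤s z≤n) len≥3

  vert-repeat⇒ends : ∀ {i j} → i < j → j ≤ L → vert i ≡ vert j → i ≡ 0 × j ≡ L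
  vert-repeat⇒ends {i} {j} i<j j≤L eq with m≤n⇒m<n∨m≡n j≤L
  ... | inj₁ j<L = ⊥-elim (<⇒≢ i<j (dist i j (<-trans i<j j<L) j<L eq))
  ... | inj₂ refl = dist i 0 i<j cycle-length-pos (trans eq close) , refl

  no-backtrack : ∀ {i} → 2 + i ≤ L → vert i ≢ vert (2 + i)
  no-backtrack 2+i≤L eq with vert-repeat⇒ends (s≤s (n≤1+n _)) 2+i≤L eq
  ... | refl , refl with len≥3
  ... | s≤s (s≤s ())

  private
    dist-positive : ∀ {i j} → 0 < i → 0 < j → i ≤ L → j ≤ L → vert i ≡ vert j → i ≡ j
    dist-positive {i} {j} 0<i 0<j i≤L j≤L eq with <-cmp i j
    ... | tri< i<j _ _ = ⊥-elim (<⇒≢ 0<i (sym (proj₁ (vert-repeat⇒ends i<j j≤L eq))))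
    ... | tri≈ _ i≡j _ = i≡j
    ... | tri> _ _ j<i = ⊥-elim (<⇒≢ 0<j (sym (proj₁ (vert-repeat⇒ends j<i i≤L (sym eq)))))

  shifted : ℕ → V G
  shifted i with i <? L
  ... | yes _ = vert (suc i)
  ... | no _ = vert 1

  shifted-< : ∀ {i} → i < L → shifted i ≡ vert (suc i)
  shifted-< {i} i<L with i <? L
  ... | yes _ = refl
  ... | no ¬i<L = ⊥-elim (¬i<L i<L)

  private
    shifted-L : shifted L ≡ vert 1
    shifted-L with L <? L
    ... | yes L<L = ⊥-elim (<-irrefl refl L<L)
    ... | no _ = refl

    shifted-adj : ∀ i → i < L → Adj G (shifted i) (shifted (suc i))
    shifted-adj i i<L rewrite shifted-< i<L with m≤n⇒m<n∨m≡n i<L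
    ... | inj₁ 1+i<L rewrite shifted-< 1+i<L = adj (suc i) 1+i<L
    ... | inj₂ refl rewrite shifted-L | close = adj 0 cycle-length-pos

  rotate₁ : Cycle G L
  rotate₁ = record
    { len≥3 = len≥3
    ; vert = shifted
    ; close = trans shifted-L (sym (shifted-< cycle-length-pos))
    ; dist = λ i j i<L j<L eq → suc-injective (dist-positive (s≤s z≤n) (s≤s z≤n) i<L j<L
               (trans (sym (shifted-< i<L)) (trans eq (shifted-< j<L))))
    ; adj = shifted-adj
    }

rotate : ∀ {G L} → ℕ → Cycle G L → Cycle G L
rotate zero C = C
rotate (suc r) C = rotate₁ (rotate r C)

rotate-vert : ∀ {G L} (C : Cycle G L) r {i} → i + r ≤ L →
              Cycle.vert (rotate r C) i ≡ Cycle.vert C (i + r)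
rotate-vert C zero {i} _ = cong (Cycle.vert C) (sym (+-identityʳ i))
rotate-vert {L = L} C (suc r) {i} i+1+r≤L = begin
  shifted (rotate r C) i           ≡⟨ shifted-< (rotate r C) (<-≤-trans (m<m+n i (s≤s z≤n)) i+1+r≤L) ⟩
  Cycle.vert (rotate r C) (suc i)  ≡⟨ rotate-vert C r (subst (_≤ L) (+-suc i r) i+1+r≤L) ⟩
  Cycle.vert C (suc i + r)         ≡⟨ cong (Cycle.vert C) (sym (+-suc i r)) ⟩
  Cycle.vert C (i + suc r)         ∎
  where open ≡-Reasoning

-- Non-backtracking closed walks

module _ {G : Graph} (_≟_ : DecidableEquality (V G))
         (adj⇒≢ : ∀ {u v} → Adj G u v → u ≢ v)
         (w : ℕ → V G) {q : ℕ}
         (walk : ∀ {j} → j < q → Adj G (w j) (w (suc j)))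
         (non-backtracking : ∀ {j} → 2 + j ≤ q → w j ≢ w (2 + j)) where

  private
    Revisit : ℕ → Set
    Revisit j = ∃ λ i → i < j × w i ≡ w j

    revisit-gap≥3 : ∀ {i} c → c + i ≤ q → 0 < c → w i ≡ w (c + i) → 3 ≤ c
    revisit-gap≥3 1 1+i≤q _ eq = ⊥-elim (adj⇒≢ (walk 1+i≤q) eq)
    revisit-gap≥3 2 2+i≤q _ eq = ⊥-elim (non-backtracking 2+i≤q eq)
    revisit-gap≥3 (suc (suc (suc _))) _ _ _ = s≤s (s≤s (s≤s z≤n))

    cycle-at-first-revisit : ∀ {i j} → j ≤ q → i < j → w i ≡ w j →
                             (∀ {j′} → j′ < j → ¬ Revisit j′) → Cycle G (j ∸ i)
    cycle-at-first-revisit {i} {j} j≤q i<j wi≡wj first = record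
      { len≥3 = revisit-gap≥3 (j ∸ i) (subst (_≤ q) (sym c+i≡j) j≤q) (m<n⇒0<n∸m i<j)
                  (trans wi≡wj (cong w (sym c+i≡j)))
      ; vert = λ l → w (l + i)
      ; close = trans (cong w c+i≡j) (sym wi≡wj)
      ; dist = dist
      ; adj = λ l l<c → walk (<-≤-trans (inside l<c) j≤q)
      }
      where
      c+i≡j : j ∸ i + i ≡ j
      c+i≡j = m∸n+n≡m (<⇒≤ i<j)
      inside : ∀ {l} → l < j ∸ i → l + i < j
      inside l<c = subst (_ <_) c+i≡j (+-monoˡ-< _ l<c)
      dist : ∀ l l′ → l < j ∸ i → l′ < j ∸ i → w (l + i) ≡ w (l′ + i) → l ≡ l′
      dist l l′ l<c l′<c eq with <-cmp l l′
      ... | tri< l<l′ _ _ = ⊥-elim (first (inside l′<c) (l + i , +-monoˡ-< i l<l′ , eq))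
      ... | tri≈ _ l≡l′ _ = l≡l′
      ... | tri> _ _ l′<l = ⊥-elim (first (inside l<c) (l′ + i , +-monoˡ-< i l′<l , sym eq))

    cycle-within : ∀ j → j ≤ q → Revisit j → ∃ λ c → c ≤ j × Cycle G c
    cycle-within = <-rec (λ j → j ≤ q → Revisit j → ∃ λ c → c ≤ j × Cycle G c) step
      where
      step : ∀ j → (∀ {j′} → j′ < j → j′ ≤ q → Revisit j′ → ∃ λ c → c ≤ j′ × Cycle G c) →
             j ≤ q → Revisit j → ∃ λ c → c ≤ j × Cycle G c
      step j earlier j≤q (i , i<j , wi≡wj)
        with anyUpTo? (λ j′ → anyUpTo? (λ i → w i ≟ w j′) j′) j
      ... | yes (j′ , j′<j , rev) with earlier j′<j (≤-trans (<⇒≤ j′<j) j≤q) rev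
      ...   | c , c≤j′ , cyc = c , ≤-trans c≤j′ (<⇒≤ j′<j) , cyc
      step j earlier j≤q (i , i<j , wi≡wj) | no none =
        j ∸ i , m∸n≤m j i ,
        cycle-at-first-revisit j≤q i<j wi≡wj (λ j′<j rev → none (_ , j′<j , rev))

  closed-walk⇒cycle : 0 < q → w q ≡ w 0 → ∃ λ c → c ≤ q × Cycle G c
  closed-walk⇒cycle 0<q wq≡w0 = cycle-within q ≤-refl (0 , 0<q , sym wq≡w0)

-- Paths and routes in G′

module _ {n m : ℕ} (E : EdgeList n m) (simple : SimpleEdges E) where

  no-loop : ∀ i → proj₁ (E i) ≢ proj₂ (E i)
  no-loop = proj₁ simple

  baseGraph-adj⇒≢ : ∀ {u v} → Adj (baseGraph E) u v → u ≢ v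
  baseGraph-adj⇒≢ (i , inj₁ refl) = no-loop i
  baseGraph-adj⇒≢ (i , inj₂ refl) u≡v = no-loop i (sym u≡v)

module _ {n m : ℕ} (E : EdgeList n m) (Sa Sb : Fin m → Bool) {t : ℕ} where
  open Construction E Sa Sb t

  sideOf : V' → Side
  sideOf (base s _) = s
  sideOf (inner s _ _ _ _ _) = s

  -- Only ever applied to base vertices; inner vertices get an arbitrary value.
  shadow : V' → Fin n
  shadow (base _ u) = u
  shadow (inner _ i _ _ _ _) = proj₁ (E i)

  data IsBase : V' → Set where
    base : ∀ s u → IsBase (base s u)

  isBase? : ∀ x → Dec (IsBase x)
  isBase? (base s u) = yes (base s u)
  isBase? (inner _ _ _ _ _ _) = no λ ()

  data Across : V' → V' → Set where
    ab : ∀ u v → Across (base sa u) (base sb v)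
    ba : ∀ u v → Across (base sb u) (base sa v)

  across? : ∀ x y → Dec (Across x y)
  across? (base sa u) (base sb v) = yes (ab u v)
  across? (base sb u) (base sa v) = yes (ba u v)
  across? (base sa _) (base sa _) = no λ ()
  across? (base sb _) (base sb _) = no λ ()
  across? (base _ _) (inner _ _ _ _ _ _) = no λ ()
  across? (inner _ _ _ _ _ _) _ = no λ ()

  Across⇒IsBaseʳ : ∀ {x y} → Across x y → IsBase y
  Across⇒IsBaseʳ (ab u v) = base sb v
  Across⇒IsBaseʳ (ba u v) = base sa v

  Across⇒sideOf≢ : ∀ {x y} → Across x y → sideOf x ≢ sideOf y
  Across⇒sideOf≢ (ab u v) ()
  Across⇒sideOf≢ (ba u v) ()

  Across-twice : ∀ {x y z} → Across x y → Across y z → shadow x ≡ shadow z → x ≡ z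
  Across-twice (ab u v) (ba .v w) u≡w = cong (base sa) u≡w
  Across-twice (ba u v) (ab .v w) u≡w = cong (base sb) u≡w

  pt-side : ∀ s i p j → sideOf (pt s i p j) ≡ s
  pt-side s i p zero = refl
  pt-side s i p (suc j) with suc j <? t
  ... | yes _ = refl
  ... | no _ = refl

  pt-inner : ∀ {s i p j} (1≤j : 1 ≤ j) (j<t : j < t) → pt s i p j ≡ inner s i p j 1≤j j<t
  pt-inner {j = suc j} (s≤s z≤n) j<t with suc j <? t
  ... | yes j<t′ rewrite <-irrelevant j<t′ j<t = refl
  ... | no j≮t = ⊥-elim (j≮t j<t)

  pt-inner-¬base : ∀ {s i p j} → 1 ≤ j → j < t → ¬ IsBase (pt s i p j)
  pt-inner-¬base {s} {i} {p} 1≤j j<t rewrite pt-inner {s} {i} {p} 1≤j j<t = λ ()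

  pt-end : 1 ≤ t → ∀ s i p {j} → t ≤ j → pt s i p j ≡ base s (proj₂ (E i))
  pt-end t≥1 s i p {zero} t≤0 = ⊥-elim (<⇒≱ t≥1 t≤0)
  pt-end _ s i p {suc j} t≤j with suc j <? t
  ... | yes j<t = ⊥-elim (<⇒≱ j<t t≤j)
  ... | no _ = refl

  pt-base⇒end : ∀ {s i p j} → IsBase (pt s i p j) → j ≤ t → j ≡ 0 ⊎ j ≡ t
  pt-base⇒end {j = zero} _ _ = inj₁ refl
  pt-base⇒end {s} {i} {p} {suc j} b j≤t with suc j <? t
  pt-base⇒end {s} {i} {p} {suc j} () j≤t | yes _
  ... | no j≮t = inj₂ (≤-antisym j≤t (≮⇒≥ j≮t))

  -- A left inverse of  pt s i p  on [0, t]; it exists because the edge i is not a loop.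
  position : Fin m → V' → ℕ
  position i (base _ u) with u Fin.≟ proj₂ (E i)
  ... | yes _ = t
  ... | no _ = 0
  position _ (inner _ _ _ j _ _) = j

  position-pt : SimpleEdges E → ∀ s i p {j} → j ≤ t → position i (pt s i p j) ≡ j
  position-pt simple s i p {zero} _ with proj₁ (E i) Fin.≟ proj₂ (E i)
  ... | yes loop = ⊥-elim (no-loop E simple i loop)
  ... | no _ = refl
  position-pt _ s i p {suc j} j<t with suc j <? t
  ... | yes _ = refl
  ... | no j≮t with proj₂ (E i) Fin.≟ proj₂ (E i)
  ...   | yes _ = ≤-antisym (≮⇒≥ j≮t) j<t
  ...   | no ≢ = ⊥-elim (≢ refl)

  pt-injective : SimpleEdges E → ∀ {s i p j j′} → j ≤ t → j′ ≤ t →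
                 pt s i p j ≡ pt s i p j′ → j ≡ j′
  pt-injective simple {s} {i} {p} {j} {j′} j≤t j′≤t eq = begin
    j                         ≡⟨ position-pt simple s i p j≤t ⟨
    position i (pt s i p j)   ≡⟨ cong (position i) eq ⟩
    position i (pt s i p j′)  ≡⟨ position-pt simple s i p j′≤t ⟩
    j′                        ∎
    where open ≡-Reasoning

  -- Injectivity of  inner ; the function g avoids an equation between differently typed presence proofs.
  pt≡inner-cong : ∀ {A : Set} (g : (s : Side) (i : Fin m) → S s i ≡ true → ℕ → A)
                  {s i p j s′ i′ p′ j′ a b} → pt s i p j ≡ inner s′ i′ p′ j′ a b →
                  g s i p j ≡ g s′ i′ p′ j′
  pt≡inner-cong g {j = zero} ()
  pt≡inner-cong g {s} {i} {p} {suc j} eq with suc j <? t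
  pt≡inner-cong g {s} {i} {p} {suc j} refl | yes _ = refl
  pt≡inner-cong g {s} {i} {p} {suc j} () | no _

  private
    arc-from-inner : ∀ {x y s i p j a b} → Arc x y → x ≡ inner s i p j a b → y ≡ pt s i p (suc j)
    arc-from-inner (rung u) ()
    arc-from-inner (step _ _ _ _ _) eq = pt≡inner-cong (λ s i p j → pt s i p (suc j)) eq

    arc-into-inner : ∀ {x y s i p j a b} → Arc y x → x ≡ inner s i p j a b → y ≡ pt s i p (pred j)
    arc-into-inner (rung u) ()
    arc-into-inner (step _ _ _ _ _) eq = pt≡inner-cong (λ s i p j → pt s i p (pred j)) eq

  pt-neighbours : ∀ {s i p j y} → 1 ≤ j → j < t → Adj G' (pt s i p j) y →
                  y ≡ pt s i p (pred j) ⊎ y ≡ pt s i p (suc j)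
  pt-neighbours 1≤j j<t (inj₁ arc) = inj₂ (arc-from-inner arc (pt-inner 1≤j j<t))
  pt-neighbours 1≤j j<t (inj₂ arc) = inj₁ (arc-into-inner arc (pt-inner 1≤j j<t))

  side-changing-arc⇒shadow≡ : ∀ {x y} → Arc x y → sideOf x ≢ sideOf y → shadow x ≡ shadow y
  side-changing-arc⇒shadow≡ (rung u) _ = refl
  side-changing-arc⇒shadow≡ (step s i p j _) ≢ =
    ⊥-elim (≢ (trans (pt-side s i p j) (sym (pt-side s i p (suc j)))))

  adj-across⇒shadow≡ : ∀ {x y} → Adj G' x y → Across x y → shadow x ≡ shadow y
  adj-across⇒shadow≡ (inj₁ arc) x↔y = side-changing-arc⇒shadow≡ arc (Across⇒sideOf≢ x↔y)
  adj-across⇒shadow≡ (inj₂ arc) x↔y = sym (side-changing-arc⇒shadow≡ arc (Across⇒sideOf≢ x↔y ∘ sym))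

  present-side-unique : ¬ (∃ λ i → Sa i ≡ true × Sb i ≡ true) →
                        ∀ {s s′ i} → S s i ≡ true → S s′ i ≡ true → s ≡ s′
  present-side-unique _ {sa} {sa} _ _ = refl
  present-side-unique _ {sb} {sb} _ _ = refl
  present-side-unique disjoint {sa} {sb} pa pb = ⊥-elim (disjoint (_ , pa , pb))
  present-side-unique disjoint {sb} {sa} pb pa = ⊥-elim (disjoint (_ , pa , pb))

  record Route : Set where
    constructor mkRoute
    field
      side : Side
      edge : Fin m
      present : S side edge ≡ true
      forward : Bool

  along : Route → ℕ → V'
  along (mkRoute s i p true) l = pt s i p l
  along (mkRoute s i p false) l = pt s i p (t ∸ l)

  source target : Route → Fin n
  source (mkRoute _ i _ true) = proj₁ (E i)
  source (mkRoute _ i _ false) = proj₂ (E i)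
  target (mkRoute _ i _ true) = proj₂ (E i)
  target (mkRoute _ i _ false) = proj₁ (E i)

  route-edge-adj : ∀ r → Adj (baseGraph E) (source r) (target r)
  route-edge-adj (mkRoute _ i _ true) = i , inj₁ refl
  route-edge-adj (mkRoute _ i _ false) = i , inj₂ refl

  along-side : ∀ r l → sideOf (along r l) ≡ Route.side r
  along-side (mkRoute s i p true) l = pt-side s i p l
  along-side (mkRoute s i p false) l = pt-side s i p (t ∸ l)

  private
    reflect-inner : ∀ {l} → 1 ≤ l → l < t → 1 ≤ t ∸ l × t ∸ l < t
    reflect-inner 1≤l l<t = m<n⇒0<n∸m l<t , ∸-monoʳ-< 1≤l (<⇒≤ l<t)

    suc[t∸suc]≡t∸ : ∀ {l} → suc l ≤ t → suc (t ∸ suc l) ≡ t ∸ l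
    suc[t∸suc]≡t∸ l<t = sym (+-∸-assoc 1 l<t)

  along-inner-¬base : ∀ r {l} → 1 ≤ l → l < t → ¬ IsBase (along r l)
  along-inner-¬base (mkRoute s i p true) 1≤l l<t = pt-inner-¬base 1≤l l<t
  along-inner-¬base (mkRoute s i p false) 1≤l l<t =
    pt-inner-¬base (proj₁ (reflect-inner 1≤l l<t)) (proj₂ (reflect-inner 1≤l l<t))

  along-adj : ∀ r {l} → l < t → Adj G' (along r l) (along r (suc l))
  along-adj (mkRoute s i p true) {l} l<t = inj₁ (step s i p l l<t)
  along-adj (mkRoute s i p false) {l} l<t =
    inj₂ (subst (λ j → Arc (pt s i p (t ∸ suc l)) (pt s i p j)) (suc[t∸suc]≡t∸ l<t)
                (step s i p (t ∸ suc l) (∸-monoʳ-< (s≤s z≤n) l<t)))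

  along-neighbours : ∀ r {l y} → 1 ≤ l → l < t → Adj G' (along r l) y →
                     y ≡ along r (pred l) ⊎ y ≡ along r (suc l)
  along-neighbours (mkRoute s i p true) 1≤l l<t adj = pt-neighbours 1≤l l<t adj
  along-neighbours (mkRoute s i p false) {suc l} 1≤l l<t adj
    with pt-neighbours (proj₁ (reflect-inner 1≤l l<t)) (proj₂ (reflect-inner 1≤l l<t)) adj
  ... | inj₁ y≡ = inj₂ (trans y≡ (cong (pt s i p) (pred[m∸n]≡m∸[1+n] t (suc l))))
  ... | inj₂ y≡ = inj₁ (trans y≡ (cong (pt s i p) (suc[t∸suc]≡t∸ (<⇒≤ l<t))))

  leave-inner : ∀ {x y} → ¬ IsBase x → Adj G' x y →
                ∃ λ r → ∃ λ l → 1 ≤ l × l < t × x ≡ along r l × y ≡ along r (suc l)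
  leave-inner {base s u} ¬base _ = ⊥-elim (¬base (base s u))
  leave-inner {inner s i p j 1≤j j<t} _ adj
    with pt-neighbours 1≤j j<t (subst (λ x → Adj G' x _) (sym (pt-inner 1≤j j<t)) adj)
  ... | inj₂ y≡ = mkRoute s i p true , j , 1≤j , j<t , sym (pt-inner 1≤j j<t) , y≡
  ... | inj₁ y≡ = mkRoute s i p false , t ∸ j ,
                  proj₁ (reflect-inner 1≤j j<t) , proj₂ (reflect-inner 1≤j j<t) ,
                  trans (sym (pt-inner 1≤j j<t)) (cong (pt s i p) (sym j≡)) ,
                  trans y≡ (cong (pt s i p) (trans (cong pred (sym j≡)) (pred[m∸n]≡m∸[1+n] t (t ∸ j))))
    where
    j≡ : t ∸ (t ∸ j) ≡ j
    j≡ = m∸[m∸n]≡n (<⇒≤ j<t)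

  module _ (simple : SimpleEdges E) (t≥1 : 1 ≤ t) where

    along-0 : ∀ r → along r 0 ≡ base (Route.side r) (source r)
    along-0 (mkRoute s i p true) = refl
    along-0 (mkRoute s i p false) = pt-end t≥1 s i p ≤-refl

    along-t : ∀ r → along r t ≡ base (Route.side r) (target r)
    along-t (mkRoute s i p true) = pt-end t≥1 s i p ≤-refl
    along-t (mkRoute s i p false) rewrite n∸n≡0 t = refl

    along-injective : ∀ r {l l′} → l ≤ t → l′ ≤ t → along r l ≡ along r l′ → l ≡ l′
    along-injective (mkRoute s i p true) l≤t l′≤t eq = pt-injective simple l≤t l′≤t eq
    along-injective (mkRoute s i p false) {l} {l′} l≤t l′≤t eq =
      ∸-cancelˡ-≡ l≤t l′≤t (pt-injective simple (m∸n≤m t l) (m∸n≤m t l′) eq)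

    departure : ∀ {x y} → IsBase x → Adj G' x y → ¬ Across x y →
                ∃ λ r → x ≡ along r 0 × y ≡ along r 1
    departure _ (inj₁ (rung u)) ¬across = ⊥-elim (¬across (ab u u))
    departure _ (inj₂ (rung u)) ¬across = ⊥-elim (¬across (ba u u))
    departure base-x (inj₁ (step s i p j j<t)) _ with pt-base⇒end base-x (<⇒≤ j<t)
    ... | inj₁ refl = mkRoute s i p true , refl , refl
    ... | inj₂ refl = ⊥-elim (<-irrefl refl j<t)
    departure base-x (inj₂ (step s i p j j<t)) _ with pt-base⇒end base-x j<t
    ... | inj₂ refl = mkRoute s i p false , refl , refl

    reversed-edge : ∀ r r′ → source r ≡ target r′ → target r ≡ source r′ →
                    Route.edge r ≡ Route.edge r′ × Route.forward r ≢ Route.forward r′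
    reversed-edge (mkRoute _ i _ true) (mkRoute _ i′ _ true) s≡t t≡s
      with proj₂ simple i i′ (inj₂ (s≡t , t≡s))
    ... | refl = ⊥-elim (no-loop E simple i s≡t)
    reversed-edge (mkRoute _ i _ true) (mkRoute _ i′ _ false) s≡t t≡s =
      proj₂ simple i i′ (inj₁ (cong₂ _,_ s≡t t≡s)) , λ ()
    reversed-edge (mkRoute _ i _ false) (mkRoute _ i′ _ true) s≡t t≡s =
      proj₂ simple i i′ (inj₁ (cong₂ _,_ t≡s s≡t)) , λ ()
    reversed-edge (mkRoute _ i _ false) (mkRoute _ i′ _ false) s≡t t≡s
      with proj₂ simple i i′ (inj₂ (t≡s , s≡t))
    ... | refl = ⊥-elim (no-loop E simple i (sym s≡t))

    opposite-routes : ∀ {r r′} → Route.side r ≡ Route.side r′ → Route.edge r ≡ Route.edge r′ →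
                      Route.forward r ≢ Route.forward r′ →
                      ∀ {l} → l ≤ t → along r (t ∸ l) ≡ along r′ l
    opposite-routes {mkRoute s i p true} {mkRoute .s .i p′ true} refl refl ≢ _ = ⊥-elim (≢ refl)
    opposite-routes {mkRoute s i p false} {mkRoute .s .i p′ false} refl refl ≢ _ = ⊥-elim (≢ refl)
    opposite-routes {mkRoute s i p true} {mkRoute .s .i p′ false} refl refl _ _
      rewrite Decidable⇒UIP.≡-irrelevant Bool._≟_ p p′ = refl
    opposite-routes {mkRoute s i p false} {mkRoute .s .i p′ true} refl refl _ l≤t
      rewrite Decidable⇒UIP.≡-irrelevant Bool._≟_ p p′ = cong (pt s i p′) (m∸[m∸n]≡n l≤t)

    -- Cycles of G′

    module _ {L : ℕ} (C : Cycle G' L) where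
      open Cycle C

      private
        follow-pair : ∀ r {a l} → vert a ≡ along r l → vert (suc a) ≡ along r (suc l) →
                      ∀ k → suc k + l ≤ t → suc k + a ≤ L →
                      vert (k + a) ≡ along r (k + l) × vert (suc k + a) ≡ along r (suc k + l)
        follow-pair r start₀ start₁ zero _ _ = start₀ , start₁
        follow-pair r {a} start₀ start₁ (suc k) k+l<t k+a<L
          with follow-pair r start₀ start₁ k (<⇒≤ k+l<t) (<⇒≤ k+a<L)
        ... | previous , current
          with along-neighbours r (s≤s z≤n) k+l<t
                 (subst (λ x → Adj G' x _) current (adj (suc k + a) k+a<L))
        ... | inj₂ next = current , next
        ... | inj₁ back = ⊥-elim (no-backtrack C k+a<L (trans previous (sym back)))

      -- Inner vertices have degree two and a cycle does not backtrack.
      follow : ∀ r {a l} → vert a ≡ along r l → vert (suc a) ≡ along r (suc l) →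
               ∀ k → k + l ≤ t → k + a ≤ L → vert (k + a) ≡ along r (k + l)
      follow r start₀ start₁ zero _ _ = start₀
      follow r start₀ start₁ (suc k) k+l≤t k+a≤L =
        proj₂ (follow-pair r start₀ start₁ k k+l≤t k+a≤L)

      base-vertex : ∃ λ a → a < L × IsBase (vert a)
      base-vertex with isBase? (vert 0)
      ... | yes base₀ = 0 , cycle-length-pos C , base₀
      ... | no ¬base₀ with leave-inner ¬base₀ (adj 0 (cycle-length-pos C))
      ...   | r , l , 1≤l , l<t , start₀ , start₁ with t ∸ l <? L
      ...     | yes t∸l<L = t ∸ l , t∸l<L ,
                  subst (λ a → IsBase (vert a)) (+-identityʳ (t ∸ l))
                    (subst IsBase (sym reaches-end) (base _ _))
        where
        reaches-end : vert (t ∸ l + 0) ≡ base (Route.side r) (target r)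
        reaches-end = trans (follow r start₀ start₁ (t ∸ l) (≤-reflexive k+l≡t)
                                    (subst (_≤ L) (sym (+-identityʳ _)) (<⇒≤ t∸l<L)))
                            (trans (cong (along r) k+l≡t) (along-t r))
          where
          k+l≡t : t ∸ l + l ≡ t
          k+l≡t = m∸n+n≡m (<⇒≤ l<t)
      ...     | no t∸l≮L = ⊥-elim (<⇒≢ (cycle-length-pos C)
                             (sym (+-cancelʳ-≡ l L 0 (along-injective r L+l≤t (<⇒≤ l<t) wraps))))
        where
        L+l≤t : L + l ≤ t
        L+l≤t = subst (L + l ≤_) (m∸n+n≡m (<⇒≤ l<t)) (+-monoˡ-≤ l (≮⇒≥ t∸l≮L))
        wraps : along r (L + l) ≡ along r l
        wraps = trans (sym (follow r start₀ start₁ L L+l≤t (≤-reflexive (+-identityʳ L))))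
                      (trans (cong vert (+-identityʳ L)) (trans close start₀))

      no-double-crossing : ∀ {a} → 2 + a ≤ L →
                           Across (vert a) (vert (1 + a)) → Across (vert (1 + a)) (vert (2 + a)) → ⊥
      no-double-crossing 2+a≤L x y = no-backtrack C 2+a≤L
        (Across-twice x y (trans (adj-across⇒shadow≡ (adj _ (<⇒≤ 2+a≤L)) x)
                                 (adj-across⇒shadow≡ (adj _ 2+a≤L) y)))

      Departs : ℕ → Set
      Departs a = IsBase (vert a) × ¬ Across (vert a) (vert (suc a))

    based-cycle : ∀ {L} (C : Cycle G' L) → Σ (Cycle G' L) λ C′ → IsBase (Cycle.vert C′ 0)
    based-cycle C with base-vertex C
    ... | a , a<L , base-a = rotate a C , subst IsBase (sym (rotate-vert C a (<⇒≤ a<L))) base-a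

    departing-cycle : ∀ {L} (C : Cycle G' L) → IsBase (Cycle.vert C 0) →
                      Σ (Cycle G' L) λ C′ → Departs C′ 0
    departing-cycle {L} C base₀ with across? (Cycle.vert C 0) (Cycle.vert C 1)
    ... | no ¬across = C , base₀ , ¬across
    ... | yes across = rotate 1 C , subst IsBase (sym vert₀) (Across⇒IsBaseʳ across) ,
                       λ across′ → no-double-crossing C 2≤L across
                                     (subst₂ Across vert₀ vert₁ across′)
      where
      2≤L : 2 ≤ L
      2≤L = ≤-trans (n≤1+n 2) (Cycle.len≥3 C)
      vert₀ : Cycle.vert (rotate 1 C) 0 ≡ Cycle.vert C 1
      vert₀ = rotate-vert C 1 (<⇒≤ 2≤L)
      vert₁ : Cycle.vert (rotate 1 C) 1 ≡ Cycle.vert C 2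
      vert₁ = rotate-vert C 1 2≤L

    module Decomposition {L : ℕ} (C : Cycle G' L) (departs₀ : Departs C 0) where
      open Cycle C

      record Segment (a : ℕ) : Set where
        field
          route : Route
          fits : ∀ {k} → k ≤ t → vert (k + a) ≡ along route k
          within : t + a ≤ L

      segment-end : ∀ {a} (seg : Segment a) →
                    vert (t + a) ≡ base (Route.side (Segment.route seg)) (target (Segment.route seg))
      segment-end seg = trans (Segment.fits seg ≤-refl) (along-t (Segment.route seg))

      segment : ∀ {a} → a < L → Departs C a → Segment a
      segment {a} a<L (base-a , ¬across) with departure base-a (adj a a<L) ¬across
      ... | r , start₀ , start₁ = record
        { route = r
        ; fits = λ k≤t → on-route k≤t (≤-trans (+-monoˡ-≤ a k≤t) within)
        ; within = within
        }
        where
        on-route : ∀ {k} → k ≤ t → k + a ≤ L → vert (k + a) ≡ along r k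
        on-route {k} k≤t k+a≤L = subst (λ l → vert (k + a) ≡ along r l) (+-identityʳ k)
          (follow C r start₀ start₁ k (subst (_≤ t) (sym (+-identityʳ k)) k≤t) k+a≤L)
        -- Otherwise the cycle would close up at the base vertex  vert 0  strictly inside the path.
        within : t + a ≤ L
        within with t + a ≤? L
        ... | yes t+a≤L = t+a≤L
        ... | no t+a≰L = ⊥-elim (along-inner-¬base r 1≤k k<t
                           (subst IsBase (on-route (<⇒≤ k<t) (≤-reflexive k+a≡L)) base-L))
          where
          k+a≡L : L ∸ a + a ≡ L
          k+a≡L = m∸n+n≡m (<⇒≤ a<L)
          1≤k : 1 ≤ L ∸ a
          1≤k = m<n⇒0<n∸m a<L
          k<t : L ∸ a < t
          k<t = +-cancelʳ-< a (L ∸ a) t (subst (_< t + a) (sym k+a≡L) (≰⇒> t+a≰L))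
          base-L : IsBase (vert (L ∸ a + a))
          base-L = subst (λ i → IsBase (vert i)) (sym k+a≡L) (subst IsBase (sym close) (proj₁ departs₀))

      Crossing : ℕ → Set
      Crossing b = b < L × Across (vert b) (vert (suc b))

      crossing? : ∀ b → Dec (Crossing b)
      crossing? b = (b <? L) ×-dec across? (vert b) (vert (suc b))

      -- The path occupying positions a … t + a is followed by the next path, possibly after a rung.
      next : ℕ → ℕ
      next a with crossing? (t + a)
      ... | yes _ = suc (t + a)
      ... | no _ = t + a

      next-spec : ∀ a → (next a ≡ t + a × ¬ Crossing (t + a)) ⊎
                        (next a ≡ suc (t + a) × Crossing (t + a))
      next-spec a with crossing? (t + a)
      ... | yes crossing = inj₂ (refl , crossing)
      ... | no ¬crossing = inj₁ (refl , ¬crossing)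

      junction : ℕ → ℕ
      junction zero = 0
      junction (suc j) = next (junction j)

      record Progress (j a : ℕ) : Set where
        field
          bounded : a ≤ L
          departs : a < L → Departs C a
          long : j * t ≤ a

      Invariant : ℕ → Set
      Invariant j = Progress j (junction j)

      invariant-zero : Invariant 0
      invariant-zero = record { bounded = z≤n ; departs = λ _ → departs₀ ; long = z≤n }

      progress-next : ∀ {j a} → Progress j a → a < L → Progress (suc j) (next a) × a < next a
      progress-next {j} {a} P a<L with next a | next-spec a
      ... | _ | inj₁ (refl , ¬crossing) = record
            { bounded = Segment.within seg
            ; departs = λ t+a<L → subst IsBase (sym (segment-end seg)) (base _ _) ,
                                  λ x → ¬crossing (t+a<L , x)
            ; long = +-monoʳ-≤ t (Progress.long P)
            } , m<n+m a t≥1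
        where
        seg : Segment a
        seg = segment a<L (Progress.departs P a<L)
      ... | _ | inj₂ (refl , t+a<L , across) = record
            { bounded = t+a<L
            ; departs = λ 1+t+a<L → Across⇒IsBaseʳ across , no-double-crossing C 1+t+a<L across
            ; long = ≤-trans (+-monoʳ-≤ t (Progress.long P)) (n≤1+n _)
            } , ≤-trans (m<n+m a t≥1) (n≤1+n _)

      private
        reached : ∃ λ q → junction q ≡ L × Invariant q ×
                          (∀ {i} → i < q → Invariant i × junction i < L)
        reached = reaches-bound junction Invariant L invariant-zero Progress.bounded progress-next

      q : ℕ
      q = proj₁ reached

      junction-last : junction q ≡ L
      junction-last = proj₁ (proj₂ reached)

      invariant-last : Invariant q
      invariant-last = proj₁ (proj₂ (proj₂ reached))

      segment-of : ∀ {j} → j < q → Segment (junction j)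
      segment-of j<q with proj₂ (proj₂ (proj₂ reached)) j<q
      ... | I , a<L = segment a<L (Progress.departs I a<L)

      route-of : ∀ {j} → j < q → Route
      route-of j<q = Segment.route (segment-of j<q)

      walk : ℕ → Fin n
      walk j = shadow (vert (junction j))

      walk-closed : walk q ≡ walk 0
      walk-closed = cong shadow (trans (cong vert junction-last) close)

      q-pos : 0 < q
      q-pos = n≢0⇒n>0 λ q≡0 →
        <⇒≢ (cycle-length-pos C) (trans (cong junction (sym q≡0)) junction-last)

      walk-source : ∀ {j} (j<q : j < q) → walk j ≡ source (route-of j<q)
      walk-source j<q = cong shadow (trans (Segment.fits (segment-of j<q) z≤n) (along-0 (route-of j<q)))

      shadow-next : ∀ {a} (seg : Segment a) → shadow (vert (next a)) ≡ target (Segment.route seg)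
      shadow-next {a} seg with next a | next-spec a
      ... | _ | inj₁ (refl , _) = cong shadow (segment-end seg)
      ... | _ | inj₂ (refl , t+a<L , across) =
            trans (sym (adj-across⇒shadow≡ (adj _ t+a<L) across)) (cong shadow (segment-end seg))

      walk-target : ∀ {j} (j<q : j < q) → walk (suc j) ≡ target (route-of j<q)
      walk-target j<q = shadow-next (segment-of j<q)

      walk-adj : ∀ {j} → j < q → Adj (baseGraph E) (walk j) (walk (suc j))
      walk-adj j<q = subst₂ (Adj (baseGraph E)) (sym (walk-source j<q)) (sym (walk-target j<q))
                            (route-edge-adj (route-of j<q))

      private
        -- Without a rung between the two paths the cycle meets  vert (t ∸ 1 + a)  again two steps later;
        -- a rung would change the side.
        return-impossible : ∀ {a} (seg : Segment a) (seg′ : Segment (next a)) →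
                            Route.side (Segment.route seg) ≡ Route.side (Segment.route seg′) →
                            vert (t ∸ 1 + a) ≢ vert (suc (next a))
        return-impossible {a} seg seg′ same-side meet with next a | next-spec a
        ... | _ | inj₁ (refl , _) =
              no-backtrack C (subst (_≤ L) (cong (λ x → suc (x + a)) (sym t≡)) bound)
                             (trans meet (cong (λ x → vert (suc (x + a))) (sym t≡)))
          where
          t≡ : suc (t ∸ 1) ≡ t
          t≡ = m+[n∸m]≡n t≥1
          bound : suc (t + a) ≤ L
          bound = ≤-trans (+-monoˡ-≤ (t + a) t≥1) (Segment.within seg′)
        ... | _ | inj₂ (refl , _ , across) =
              Across⇒sideOf≢ across (trans side-before (trans same-side (sym side-after)))
          where
          side-before : sideOf (vert (t + a)) ≡ Route.side (Segment.route seg)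
          side-before = cong sideOf (segment-end seg)
          side-after : sideOf (vert (suc (t + a))) ≡ Route.side (Segment.route seg′)
          side-after = trans (cong sideOf (Segment.fits seg′ z≤n)) (along-side (Segment.route seg′) 0)

      walk-non-backtracking : ¬ (∃ λ i → Sa i ≡ true × Sb i ≡ true) →
                              ∀ {j} → 2 + j ≤ q → walk j ≢ walk (2 + j)
      walk-non-backtracking disjoint {j} 2+j≤q eq = return-impossible seg seg′ same-side meet
        where
        j<q : j < q
        j<q = ≤-trans (n≤1+n (suc j)) 2+j≤q
        seg : Segment (junction j)
        seg = segment-of j<q
        seg′ : Segment (junction (suc j))
        seg′ = segment-of 2+j≤q
        r r′ : Route
        r = Segment.route seg
        r′ = Segment.route seg′
        reversed : Route.edge r ≡ Route.edge r′ × Route.forward r ≢ Route.forward r′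
        reversed = reversed-edge r r′ (trans (sym (walk-source j<q)) (trans eq (walk-target 2+j≤q)))
                                      (trans (sym (walk-target j<q)) (walk-source 2+j≤q))
        same-side : Route.side r ≡ Route.side r′
        same-side = present-side-unique disjoint (Route.present r)
                      (subst (λ i → S (Route.side r′) i ≡ true) (sym (proj₁ reversed))
                             (Route.present r′))
        meet : vert (t ∸ 1 + junction j) ≡ vert (suc (junction (suc j)))
        meet = trans (Segment.fits seg (m∸n≤m t 1))
                 (trans (opposite-routes same-side (proj₁ reversed) (proj₂ reversed) t≥1)
                        (sym (Segment.fits seg′ t≥1)))

      length-bound : ¬ (∃ λ i → Sa i ≡ true × Sb i ≡ true) →
                     ∀ {k} → GirthAtLeast (baseGraph E) (2 * k + 1) → (2 * k + 1) * t ≤ L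
      length-bound disjoint {k} girth
        with closed-walk⇒cycle {G = baseGraph E} Fin._≟_ (baseGraph-adj⇒≢ E simple) walk walk-adj
               (walk-non-backtracking disjoint) q-pos walk-closed
      ... | c , c≤q , cyc = begin
        (2 * k + 1) * t  ≤⟨ *-monoˡ-≤ t (≤-trans (girth c cyc) c≤q) ⟩
        q * t            ≤⟨ Progress.long invariant-last ⟩
        junction q           ≡⟨ junction-last ⟩
        L                ∎
        where open ≤-Reasoning

    girth-lower-bound : ¬ (∃ λ i → Sa i ≡ true × Sb i ≡ true) →
                        ∀ {k} → GirthAtLeast (baseGraph E) (2 * k + 1) → GirthAtLeast G' ((2 * k + 1) * t)
    girth-lower-bound disjoint {k} girth L C with based-cycle C
    ... | C₁ , base₁ with departing-cycle C₁ base₁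
    ...   | C₂ , departs₂ = Decomposition.length-bound C₂ departs₂ disjoint {k} girth

    -- An edge present on both sides

    module _ {i : Fin m} (pa : Sa i ≡ true) (pb : Sb i ≡ true) where
      private
        ra rb : Route
        ra = mkRoute sa i pa true
        rb = mkRoute sb i pb false

        ℓ : ℕ
        ℓ = suc t + suc t

        -- Along edge i on side a, across the rung at  proj₂ (E i),  back along edge i on side b,
        -- and across the rung at  proj₁ (E i).
        loop : ℕ → V'
        loop l with l ≤? t
        ... | yes _ = along ra l
        ... | no _ with l ∸ suc t ≤? t
        ...   | yes _ = along rb (l ∸ suc t)
        ...   | no _ = along ra 0

        loop-a : ∀ {l} → l ≤ t → loop l ≡ along ra l
        loop-a {l} l≤t with l ≤? t
        ... | yes _ = refl
        ... | no l≰t = ⊥-elim (l≰t l≤t)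

        loop-b : ∀ {l} → t < l → l ∸ suc t ≤ t → loop l ≡ along rb (l ∸ suc t)
        loop-b {l} t<l x≤t with l ≤? t
        ... | yes l≤t = ⊥-elim (<⇒≱ t<l l≤t)
        ... | no _ with l ∸ suc t ≤? t
        ...   | yes _ = refl
        ...   | no x≰t = ⊥-elim (x≰t x≤t)

        loop-end : loop ℓ ≡ along ra 0
        loop-end with ℓ ≤? t
        ... | yes ℓ≤t = ⊥-elim (<⇒≱ (m≤m+n (suc t) (suc t)) ℓ≤t)
        ... | no _ with ℓ ∸ suc t ≤? t
        ...   | yes x≤t = ⊥-elim (1+n≰n (subst (_≤ t) (m+n∸m≡n (suc t) (suc t)) x≤t))
        ...   | no _ = refl

        second-half : ∀ {l} → t < l → l < ℓ → l ∸ suc t ≤ t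
        second-half {l} t<l l<ℓ =
          ≤-pred (subst (l ∸ suc t <_) (m+n∸m≡n (suc t) (suc t)) (∸-monoˡ-< l<ℓ t<l))

        half : ∀ l → l < ℓ → (l ≤ t × loop l ≡ along ra l) ⊎
                             (t < l × l ∸ suc t ≤ t × loop l ≡ along rb (l ∸ suc t))
        half l l<ℓ with ≤-<-connex l t
        ... | inj₁ l≤t = inj₁ (l≤t , loop-a l≤t)
        ... | inj₂ t<l = inj₂ (t<l , second-half t<l l<ℓ , loop-b t<l (second-half t<l l<ℓ))

        sides-differ : ∀ {x y} → along ra x ≢ along rb y
        sides-differ {x} {y} eq with trans (sym (along-side ra x)) (trans (cong sideOf eq) (along-side rb y))
        ... | ()

        loop-dist : ∀ l l′ → l < ℓ → l′ < ℓ → loop l ≡ loop l′ → l ≡ l′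
        loop-dist l l′ l<ℓ l′<ℓ eq with half l l<ℓ | half l′ l′<ℓ
        ... | inj₁ (l≤t , eqₗ) | inj₁ (l′≤t , eqₗ′) =
              along-injective ra l≤t l′≤t (trans (sym eqₗ) (trans eq eqₗ′))
        ... | inj₂ (t<l , x≤t , eqₗ) | inj₂ (t<l′ , x′≤t , eqₗ′) =
              ∸-cancelʳ-≡ t<l t<l′ (along-injective rb x≤t x′≤t (trans (sym eqₗ) (trans eq eqₗ′)))
        ... | inj₁ (_ , eqₗ) | inj₂ (_ , _ , eqₗ′) =
              ⊥-elim (sides-differ {l} {l′ ∸ suc t} (trans (sym eqₗ) (trans eq eqₗ′)))
        ... | inj₂ (_ , _ , eqₗ) | inj₁ (_ , eqₗ′) =
              ⊥-elim (sides-differ {l′} {l ∸ suc t} (trans (sym eqₗ′) (trans (sym eq) eqₗ)))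

        loop-adj : ∀ l → l < ℓ → Adj G' (loop l) (loop (suc l))
        loop-adj l l<ℓ with half l l<ℓ
        ... | inj₁ (l≤t , eqₗ) with m≤n⇒m<n∨m≡n l≤t
        ...   | inj₁ l<t = subst₂ (Adj G') (sym eqₗ) (sym (loop-a l<t)) (along-adj ra l<t)
        ...   | inj₂ refl = subst₂ (Adj G') (sym (trans eqₗ (along-t ra)))
                              (sym (trans (loop-b (n<1+n t) (m∸n≤m t t))
                                          (trans (cong (along rb) (n∸n≡0 t)) (along-0 rb))))
                              (inj₁ (rung (proj₂ (E i))))
        loop-adj l l<ℓ | inj₂ (t<l , x≤t , eqₗ) with m≤n⇒m<n∨m≡n l<ℓ
        ... | inj₁ l+1<ℓ = subst₂ (Adj G') (sym eqₗ)
                             (sym (trans (loop-b (m<n⇒m<1+n t<l) (second-half (m<n⇒m<1+n t<l) l+1<ℓ))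
                                         (cong (along rb) (+-∸-assoc 1 t<l))))
                             (along-adj rb (subst (_≤ t) (+-∸-assoc 1 t<l)
                                                  (second-half (m<n⇒m<1+n t<l) l+1<ℓ)))
        ... | inj₂ refl = subst₂ (Adj G')
                            (sym (trans eqₗ (trans (cong (along rb) (m+n∸n≡m t (suc t))) (along-t rb))))
                            (sym (trans loop-end (along-0 ra)))
                            (inj₂ (rung (proj₁ (E i))))

      shared-edge⇒cycle : Cycle G' (suc t + suc t)
      shared-edge⇒cycle = record
        { len≥3 = ≤-trans (n≤1+n 3) (+-mono-≤ (s≤s t≥1) (s≤s t≥1))
        ; vert = loop
        ; close = trans loop-end (sym (loop-a z≤n))
        ; dist = loop-dist
        ; adj = loop-adj
        }

    girth-upper-bound : (∃ λ i → Sa i ≡ true × Sb i ≡ true) → GirthAtMost G' (2 * t + 2)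
    girth-upper-bound (_ , pa , pb) = suc t + suc t , ≤-reflexive (2+t+t≡2t+2 t) , shared-edge⇒cycle pa pb
      where
      2+t+t≡2t+2 : ∀ t → suc t + suc t ≡ 2 * t + 2
      2+t+t≡2t+2 = solve-∀

lemma5 : (k t n m : ℕ) → 1 ≤ k → 1 ≤ t →
         (E : EdgeList n m) → SimpleEdges E →
         GirthAtLeast (baseGraph E) (2 * k + 1) →
         (Sa Sb : Fin m → Bool) →
         ((∃ λ i → Sa i ≡ true × Sb i ≡ true) →
            GirthAtMost (Construction.G' E Sa Sb t) (2 * t + 2))
         ×
         (¬ (∃ λ i → Sa i ≡ true × Sb i ≡ true) →
            GirthAtLeast (Construction.G' E Sa Sb t) ((2 * k + 1) * t))
lemma5 k t n m _ t≥1 E simple girth Sa Sb =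
  girth-upper-bound E Sa Sb simple t≥1 ,
  λ disjoint → girth-lower-bound E Sa Sb simple t≥1 disjoint {k} girth
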